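{- Let $T$ be a decomposition tree and $v$ an internal node of $T$ labeled $\odot$, with left child $v_l$ and right child $v_r$. Then $\hat\alpha(v)=\hat\alpha(v_l)+\hat\alpha(v_r)$.
   Context: All graphs are finite, simple and undirected. For a graph $H$ and $S\subseteq V(H)$, $N_H[S]$ is the closed neighbourhood of $S$ in $H$ and $H[S]$ the induced subgraph; a graph with no vertices is regarded as having a (empty) perfect matching. A decomposition tree is a rooted tree $T$ in which every internal node has exactly two children, a left child $v_l$ and a right child $v_r$, and carries one of the labels $\otimes$ (true twin), $\odot$ (false twin), $\oplus$ (attachment). To each node $v$ are associated a graph $\hat G(v)$ and a twin set $\hat{TS}(v)\subseteq V(\hat G(v))$: for a leaf, $\hat G(v)$ is a single vertex $x$ (distinct leaves giving distinct vertices) and $\hat{TS}(v)=\{x\}$; for an internal node $v$, $V(\hat G(v))=V(\hat G(v_l))\cup V(\hat G(v_r))$ and: if $v$ is labeled $\otimes$, $E(\hat G(v))=E(\hat G(v_l))\cup E(\hat G(v_r))\cup\{xy: x\in \hat{TS}(v_l), y\in\hat{TS}(v_r)\}$ and $\hat{TS}(v)=\hat{TS}(v_l)\cup\hat{TS}(v_r)$; if labeled $\odot$, $E(\hat G(v))=E(\hat G(v_l))\cup E(\hat G(v_r))$ and $\hat{TS}(v)=\hat{TS}(v_l)\cup\hat{TS}(v_r)$; if labeled $\oplus$, the edge set is as for $\otimes$ and $\hat{TS}(v)=\hat{TS}(v_l)$. For a node $u$ and $0\le k\le|\hat{TS}(u)|$, $\hat\gamma_k(u)$ is the minimum of $|S|$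 over all $S\subseteq V(\hat G(u))$ with $V(\hat G(u))\setminus \hat{TS}(u)\subseteq N_{\hat G(u)}[S]$ for which there is $X\subseteq S\cap\hat{TS}(u)$, $|X|=k$, such that $\hat G(u)[S\setminus X]$ has a perfect matching. Let $\widehat{\min}(u)=\min\{\hat\gamma_k(u):0\le k\le|\hat{TS}(u)|\}$ and let $\hat\alpha(u)$ be the smallest $k$ with $\hat\gamma_k(u)=\widehat{\min}(u)$. -}

module Defs where

open import Data.Nat using (ℕ; zero; suc; _+_; _≤_; _<_)
open import Data.Bool using (Bool; true; false; _∧_; not)
open import Data.List using (List; []; _∷_; _++_; map)
open import Data.Unit using (⊤)
open import Data.Empty using (⊥)
open import Data.Product using (Σ; Σ-syntax; _×_; _,_)
open import Data.Sum using (_⊎_)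
open import Relation.Nullary using (¬_)
open import Relation.Binary.PropositionalEquality using (_≡_)

-- Node labels: ⊗ (true twin), ⊙ (false twin), ⊕ (attachment)
data Label : Set where
  ⊗ ⊙ ⊕ : Label

data Tree : Set where
  leaf : Tree
  node : Label → Tree → Tree → Tree

-- s ≼ t : s is (the subtree rooted at) a node of t
data _≼_ : Tree → Tree → Set where
  here  : ∀ {t} → t ≼ t
  left  : ∀ {s a l r} → s ≼ l → s ≼ node a l r
  right : ∀ {s a l r} → s ≼ r → s ≼ node a l r

-- Vertices of Ĝ(t): one per leaf of t (distinct leaves, distinct vertices)
data Vtx : Tree → Set where
  leafV : Vtx leaf
  inl   : ∀ {a l r} → Vtx l → Vtx (node a l r)
  inr   : ∀ {a l r} → Vtx r → Vtx (node a l r)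

allV : (t : Tree) → List (Vtx t)
allV leaf = leafV ∷ []
allV (node a l r) = map inl (allV l) ++ map inr (allV r)

TS : (t : Tree) → Vtx t → Set
TS leaf leafV = ⊤
TS (node ⊗ l r) (inl x) = TS l x
TS (node ⊗ l r) (inr y) = TS r y
TS (node ⊙ l r) (inl x) = TS l x
TS (node ⊙ l r) (inr y) = TS r y
TS (node ⊕ l r) (inl x) = TS l x
TS (node ⊕ l r) (inr y) = ⊥

Cross : (a : Label) (l r : Tree) → Vtx l → Vtx r → Set
Cross ⊗ l r x y = TS l x × TS r y
Cross ⊙ l r x y = ⊥
Cross ⊕ l r x y = TS l x × TS r y

-- edge relation of Ĝ(t) (symmetric and irreflexive by construction)
Edge : (t : Tree) → Vtx t → Vtx t → Set
Edge leaf leafV leafV = ⊥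
Edge (node a l r) (inl x) (inl y) = Edge l x y
Edge (node a l r) (inr x) (inr y) = Edge r x y
Edge (node a l r) (inl x) (inr y) = Cross a l r x y
Edge (node a l r) (inr y) (inl x) = Cross a l r x y

Subset : Tree → Set
Subset t = Vtx t → Bool

count : {A : Set} → (A → Bool) → List A → ℕ
count P [] = 0
count P (x ∷ xs) with P x
... | true  = suc (count P xs)
... | false = count P xs

size : {t : Tree} → Subset t → ℕ
size {t} S = count S (allV t)

InClosedNbhd : (t : Tree) → Subset t → Vtx t → Set
InClosedNbhd t S x = Σ[ y ∈ Vtx t ] (S y ≡ true × (y ≡ x ⊎ Edge t y x))

HasPerfectMatching : (t : Tree) → Subset t → Set₁
HasPerfectMatching t S =
  Σ[ M ∈ (Vtx t → Vtx t → Set) ]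
    ((∀ x y → M x y → M y x)
    × (∀ x y → M x y → Edge t x y × S x ≡ true × S y ≡ true)
    × (∀ x → S x ≡ true → Σ[ y ∈ Vtx t ] (M x y × (∀ z → M x z → z ≡ y))))

Feasible : (t : Tree) → ℕ → Subset t → Set₁
Feasible t k S =
  (∀ x → ¬ TS t x → InClosedNbhd t S x)
  × Σ[ X ∈ Subset t ]
      ((∀ x → X x ≡ true → S x ≡ true × TS t x)
      × size X ≡ k
      × HasPerfectMatching t (λ x → S x ∧ not (X x)))

IsGammaHat : (t : Tree) → ℕ → ℕ → Set₁
IsGammaHat t k g =
  (Σ[ S ∈ Subset t ] (Feasible t k S × size S ≡ g))
  × (∀ S → Feasible t k S → g ≤ size S)

IsMinHat : (t : Tree) → ℕ → Set₁
IsMinHat t m =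
  (Σ[ k ∈ ℕ ] IsGammaHat t k m)
  × (∀ k g → IsGammaHat t k g → m ≤ g)

IsAlphaHat : (t : Tree) → ℕ → Set₁
IsAlphaHat t a =
  Σ[ m ∈ ℕ ] (IsMinHat t m × IsGammaHat t a m × (∀ k → k < a → ¬ IsGammaHat t k m))

{-# OPTIONS --safe #-}
module Submission where

-- At a ⊙ node there are no edges between the two sides and the twin set is
-- the union of the children's twin sets, so a set S is feasible for γ̂_k(v)
-- exactly when its two halves are feasible for γ̂_kl(v_l) and γ̂_kr(v_r) with
-- k = kl + kr.  Hence min̂(v) = min̂(v_l) + min̂(v_r), and a set of size min̂(v)
-- splits into halves that are optimal on each side.  Thus γ̂_k(v) = min̂(v)
-- iff k = kl + kr with γ̂_kl(v_l) = min̂(v_l) and γ̂_kr(v_r) = min̂(v_r), and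
-- the least such k is α̂(v_l) + α̂(v_r).

open import Defs
open import Data.Nat using (ℕ; suc; _+_; _≤_; _<_)
open import Data.Nat.Properties
open import Data.Nat.Induction using (<-wellFounded)
open import Data.Bool using (Bool; true; false)
open import Data.List using (List; []; _∷_; _++_; map)
open import Data.Empty using (⊥; ⊥-elim)
open import Data.Product using (Σ-syntax; _×_; _,_; proj₁; proj₂)
open import Data.Sum using (inj₁; inj₂; map₁)
open import Induction.WellFounded using (Acc; acc)
open import Relation.Nullary using (¬_)
open import Relation.Binary.PropositionalEquality

minimal-bound⇒bound : ∀ {a p} {A : Set a} (P : A → Set p) (f : A → ℕ) (m : ℕ) →
  (∀ x → P x → (∀ y → P y → f x ≤ f y) → m ≤ f x) →
  ∀ x → P x → m ≤ f x
minimal-bound⇒bound P f m bound x = go x (<-wellFounded (f x))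
  where
  go : ∀ x → Acc _<_ (f x) → P x → m ≤ f x
  go x (acc rs) Px = ≮⇒≥ λ fx<m → <⇒≱ fx<m (bound x Px λ y Py →
    ≮⇒≥ λ fy<fx → <⇒≱ (<-trans fy<fx fx<m) (go y (rs fy<fx) Py))

m≤o⇒n≤p⇒o+p≡m+n⇒o≡m : ∀ {m n o p} → m ≤ o → n ≤ p → o + p ≡ m + n → o ≡ m
m≤o⇒n≤p⇒o+p≡m+n⇒o≡m {m} {n} {o} m≤o n≤p o+p≡m+n =
  ≤-antisym (+-cancelʳ-≤ n o m (≤-trans (+-monoʳ-≤ o n≤p) (≤-reflexive o+p≡m+n))) m≤o

count-++ : {A : Set} (P : A → Bool) (xs ys : List A) →
  count P (xs ++ ys) ≡ count P xs + count P ys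
count-++ P []       ys = refl
count-++ P (x ∷ xs) ys with P x
... | true  = cong suc (count-++ P xs ys)
... | false = count-++ P xs ys

count-map : {A B : Set} (P : B → Bool) (f : A → B) (xs : List A) →
  count P (map f xs) ≡ count (λ x → P (f x)) xs
count-map P f []       = refl
count-map P f (x ∷ xs) with P (f x)
... | true  = cong suc (count-map P f xs)
... | false = count-map P f xs

inl-injective : ∀ {a l r} {x y : Vtx l} → inl {a} {l} {r} x ≡ inl y → x ≡ y
inl-injective refl = refl

inr-injective : ∀ {a l r} {x y : Vtx r} → inr {a} {l} {r} x ≡ inr y → x ≡ y
inr-injective refl = refl

restrictˡ : ∀ {a l r} → Subset (node a l r) → Subset l
restrictˡ S x = S (inl x)

restrictʳ : ∀ {a l r} → Subset (node a l r) → Subset r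
restrictʳ S y = S (inr y)

join : ∀ {a l r} → Subset l → Subset r → Subset (node a l r)
join A B (inl x) = A x
join A B (inr y) = B y

size-node : ∀ {a l r} (S : Subset (node a l r)) →
  size S ≡ size (restrictˡ S) + size (restrictʳ S)
size-node {l = l} {r} S = begin
  count S (map inl (allV l) ++ map inr (allV r))
    ≡⟨ count-++ S (map inl (allV l)) (map inr (allV r)) ⟩
  count S (map inl (allV l)) + count S (map inr (allV r))
    ≡⟨ cong₂ _+_ (count-map S inl (allV l)) (count-map S inr (allV r)) ⟩
  size (restrictˡ S) + size (restrictʳ S) ∎
  where open ≡-Reasoning

DominatesNonTwins : (t : Tree) → Subset t → Set
DominatesNonTwins t S = ∀ x → ¬ TS t x → InClosedNbhd t S x

InClosedNbhd-inl : ∀ {a l r} {S : Subset (node a l r)} {x} →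
  InClosedNbhd l (restrictˡ S) x → InClosedNbhd (node a l r) S (inl x)
InClosedNbhd-inl (y , Sy , y≈x) = inl y , Sy , map₁ (cong inl) y≈x

InClosedNbhd-inr : ∀ {a l r} {S : Subset (node a l r)} {x} →
  InClosedNbhd r (restrictʳ S) x → InClosedNbhd (node a l r) S (inr x)
InClosedNbhd-inr (y , Sy , y≈x) = inr y , Sy , map₁ (cong inr) y≈x

InClosedNbhd-⊙-restrictˡ : ∀ {l r} {S : Subset (node ⊙ l r)} {x} →
  InClosedNbhd (node ⊙ l r) S (inl x) → InClosedNbhd l (restrictˡ S) x
InClosedNbhd-⊙-restrictˡ (inl y , Sy , inj₁ refl) = y , Sy , inj₁ refl
InClosedNbhd-⊙-restrictˡ (inl y , Sy , inj₂ y~x)  = y , Sy , inj₂ y~x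
InClosedNbhd-⊙-restrictˡ (inr y , _  , inj₁ ())
InClosedNbhd-⊙-restrictˡ (inr y , _  , inj₂ ())

InClosedNbhd-⊙-restrictʳ : ∀ {l r} {S : Subset (node ⊙ l r)} {x} →
  InClosedNbhd (node ⊙ l r) S (inr x) → InClosedNbhd r (restrictʳ S) x
InClosedNbhd-⊙-restrictʳ (inr y , Sy , inj₁ refl) = y , Sy , inj₁ refl
InClosedNbhd-⊙-restrictʳ (inr y , Sy , inj₂ y~x)  = y , Sy , inj₂ y~x
InClosedNbhd-⊙-restrictʳ (inl y , _  , inj₁ ())
InClosedNbhd-⊙-restrictʳ (inl y , _  , inj₂ ())

DominatesNonTwins-⊙-restrict : ∀ {l r} {S : Subset (node ⊙ l r)} →
  DominatesNonTwins (node ⊙ l r) S →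
  DominatesNonTwins l (restrictˡ S) × DominatesNonTwins r (restrictʳ S)
DominatesNonTwins-⊙-restrict dom =
  (λ x x∉TS → InClosedNbhd-⊙-restrictˡ (dom (inl x) x∉TS)) ,
  (λ y y∉TS → InClosedNbhd-⊙-restrictʳ (dom (inr y) y∉TS))

DominatesNonTwins-⊙-glue : ∀ {l r} {S : Subset (node ⊙ l r)} →
  DominatesNonTwins l (restrictˡ S) → DominatesNonTwins r (restrictʳ S) →
  DominatesNonTwins (node ⊙ l r) S
DominatesNonTwins-⊙-glue domˡ domʳ (inl x) x∉TS = InClosedNbhd-inl (domˡ x x∉TS)
DominatesNonTwins-⊙-glue domˡ domʳ (inr y) y∉TS = InClosedNbhd-inr (domʳ y y∉TS)

HasPerfectMatching-⊙-restrict : ∀ {l r} {C : Subset (node ⊙ l r)} →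
  HasPerfectMatching (node ⊙ l r) C →
  HasPerfectMatching l (restrictˡ C) × HasPerfectMatching r (restrictʳ C)
HasPerfectMatching-⊙-restrict {l} {r} {C} (M , M-sym , M-edge , partner) =
  ((λ x y → M (inl x) (inl y)) , (λ x y → M-sym (inl x) (inl y)) ,
   (λ x y → M-edge (inl x) (inl y)) , partnerˡ) ,
  ((λ x y → M (inr x) (inr y)) , (λ x y → M-sym (inr x) (inr y)) ,
   (λ x y → M-edge (inr x) (inr y)) , partnerʳ)
  where
  partnerˡ : ∀ x → C (inl x) ≡ true →
    Σ[ y ∈ Vtx l ] (M (inl x) (inl y) × (∀ z → M (inl x) (inl z) → z ≡ y))
  partnerˡ x Cx with partner (inl x) Cx
  ... | inl y , xMy , unique = y , xMy , λ z xMz → inl-injective (unique (inl z) xMz)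
  ... | inr y , xMy , _ = ⊥-elim (proj₁ (M-edge (inl x) (inr y) xMy))
  partnerʳ : ∀ x → C (inr x) ≡ true →
    Σ[ y ∈ Vtx r ] (M (inr x) (inr y) × (∀ z → M (inr x) (inr z) → z ≡ y))
  partnerʳ x Cx with partner (inr x) Cx
  ... | inr y , xMy , unique = y , xMy , λ z xMz → inr-injective (unique (inr z) xMz)
  ... | inl y , xMy , _ = ⊥-elim (proj₁ (M-edge (inr x) (inl y) xMy))

HasPerfectMatching-glue : ∀ {a l r} {C : Subset (node a l r)} →
  HasPerfectMatching l (restrictˡ C) → HasPerfectMatching r (restrictʳ C) →
  HasPerfectMatching (node a l r) C
HasPerfectMatching-glue {a} {l} {r} {C}
  (Mˡ , Mˡ-sym , Mˡ-edge , partnerˡ) (Mʳ , Mʳ-sym , Mʳ-edge , partnerʳ) =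
  M , M-sym , M-edge , partner
  where
  M : Vtx (node a l r) → Vtx (node a l r) → Set
  M (inl x) (inl y) = Mˡ x y
  M (inr x) (inr y) = Mʳ x y
  M _       _       = ⊥

  M-sym : ∀ x y → M x y → M y x
  M-sym (inl x) (inl y) = Mˡ-sym x y
  M-sym (inr x) (inr y) = Mʳ-sym x y

  M-edge : ∀ x y → M x y → Edge (node a l r) x y × C x ≡ true × C y ≡ true
  M-edge (inl x) (inl y) = Mˡ-edge x y
  M-edge (inr x) (inr y) = Mʳ-edge x y

  partner : ∀ x → C x ≡ true → Σ[ y ∈ Vtx (node a l r) ] (M x y × (∀ z → M x z → z ≡ y))
  partner (inl x) Cx with partnerˡ x Cx
  ... | y , xMy , unique = inl y , xMy , λ { (inl z) xMz → cong inl (unique z xMz) }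
  partner (inr x) Cx with partnerʳ x Cx
  ... | y , xMy , unique = inr y , xMy , λ { (inr z) xMz → cong inr (unique z xMz) }

Feasible-⊙-split : ∀ {l r k} {S : Subset (node ⊙ l r)} → Feasible (node ⊙ l r) k S →
  Σ[ kl ∈ ℕ ] Σ[ kr ∈ ℕ ]
    (k ≡ kl + kr × Feasible l kl (restrictˡ S) × Feasible r kr (restrictʳ S))
Feasible-⊙-split (dom , X , X⊆S∩TS , refl , pm)
  with DominatesNonTwins-⊙-restrict dom | HasPerfectMatching-⊙-restrict pm
... | domˡ , domʳ | pmˡ , pmʳ =
  size (restrictˡ X) , size (restrictʳ X) , size-node X ,
  (domˡ , restrictˡ X , (λ x → X⊆S∩TS (inl x)) , refl , pmˡ) ,
  (domʳ , restrictʳ X , (λ y → X⊆S∩TS (inr y)) , refl , pmʳ)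

Feasible-⊙-glue : ∀ {l r kl kr} {S : Subset (node ⊙ l r)} →
  Feasible l kl (restrictˡ S) → Feasible r kr (restrictʳ S) →
  Feasible (node ⊙ l r) (kl + kr) S
Feasible-⊙-glue {l} {r} {S = S}
  (domˡ , Xˡ , Xˡ⊆ , refl , pmˡ) (domʳ , Xʳ , Xʳ⊆ , refl , pmʳ) =
  DominatesNonTwins-⊙-glue domˡ domʳ , join Xˡ Xʳ , X⊆S∩TS , size-node (join Xˡ Xʳ) ,
  HasPerfectMatching-glue pmˡ pmʳ
  where
  X⊆S∩TS : ∀ x → join Xˡ Xʳ x ≡ true → S x ≡ true × TS (node ⊙ l r) x
  X⊆S∩TS (inl x) = Xˡ⊆ x
  X⊆S∩TS (inr y) = Xʳ⊆ y

-- IsMinHat only bounds the attained values γ̂_k; descent on the size of a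
-- feasible set shows that γ̂_k is attained whenever it is not vacuous.
IsMinHat⇒≤size : ∀ {t k m} {S : Subset t} → IsMinHat t m → Feasible t k S → m ≤ size S
IsMinHat⇒≤size {t} {k} {m} {S} (_ , m≤γ) =
  minimal-bound⇒bound (Feasible t k) size m
    (λ S′ F S′-minimal → m≤γ k (size S′) ((S′ , F , refl) , S′-minimal)) S

IsMinHat-unique : ∀ {t m m′} → IsMinHat t m → IsMinHat t m′ → m ≡ m′
IsMinHat-unique ((k , γ) , m≤γ) ((k′ , γ′) , m′≤γ) =
  ≤-antisym (m≤γ k′ _ γ′) (m′≤γ k _ γ)

IsMinHat-attained : ∀ {t k m} {S : Subset t} →
  IsMinHat t m → Feasible t k S → size S ≡ m → IsGammaHat t k m
IsMinHat-attained min F ∣S∣≡m = (_ , F , ∣S∣≡m) , λ _ F′ → IsMinHat⇒≤size min F′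

IsAlphaHat⇒≤ : ∀ {t m a k} → IsMinHat t m → IsAlphaHat t a → IsGammaHat t k m → a ≤ k
IsAlphaHat⇒≤ {t} {k = k} min (m′ , min′ , _ , least) γ =
  ≮⇒≥ λ k<a → least k k<a (subst (IsGammaHat t k) (IsMinHat-unique min min′) γ)

module _ {l r ml mr} (minˡ : IsMinHat l ml) (minʳ : IsMinHat r mr) where

  ⊙-min≤size : ∀ {k} {S : Subset (node ⊙ l r)} → Feasible (node ⊙ l r) k S → ml + mr ≤ size S
  ⊙-min≤size {S = S} F with Feasible-⊙-split F
  ... | _ , _ , _ , Fˡ , Fʳ =
    subst (ml + mr ≤_) (sym (size-node S)) (+-mono-≤ (IsMinHat⇒≤size minˡ Fˡ) (IsMinHat⇒≤size minʳ Fʳ))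

  IsGammaHat-⊙ : ∀ {kl kr} → IsGammaHat l kl ml → IsGammaHat r kr mr →
    IsGammaHat (node ⊙ l r) (kl + kr) (ml + mr)
  IsGammaHat-⊙ ((Sˡ , Fˡ , refl) , _) ((Sʳ , Fʳ , refl) , _) =
    (join Sˡ Sʳ , Feasible-⊙-glue Fˡ Fʳ , size-node (join Sˡ Sʳ)) , λ _ F → ⊙-min≤size F

  IsMinHat-⊙ : IsMinHat (node ⊙ l r) (ml + mr)
  IsMinHat-⊙ =
    (_ , IsGammaHat-⊙ (proj₂ (proj₁ minˡ)) (proj₂ (proj₁ minʳ))) ,
    λ { _ _ ((_ , F , refl) , _) → ⊙-min≤size F }

  ⊙-optimal-split : ∀ {k} {S : Subset (node ⊙ l r)} →
    Feasible (node ⊙ l r) k S → size S ≡ ml + mr →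
    Σ[ kl ∈ ℕ ] Σ[ kr ∈ ℕ ] (k ≡ kl + kr × IsGammaHat l kl ml × IsGammaHat r kr mr)
  ⊙-optimal-split {S = S} F ∣S∣≡m with Feasible-⊙-split F
  ... | kl , kr , k≡kl+kr , Fˡ , Fʳ =
    kl , kr , k≡kl+kr , IsMinHat-attained minˡ Fˡ ∣Sˡ∣≡ml , IsMinHat-attained minʳ Fʳ ∣Sʳ∣≡mr
    where
    ml≤∣Sˡ∣ : ml ≤ size (restrictˡ S)
    ml≤∣Sˡ∣ = IsMinHat⇒≤size minˡ Fˡ
    mr≤∣Sʳ∣ : mr ≤ size (restrictʳ S)
    mr≤∣Sʳ∣ = IsMinHat⇒≤size minʳ Fʳ
    halves≡m : size (restrictˡ S) + size (restrictʳ S) ≡ ml + mr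
    halves≡m = trans (sym (size-node S)) ∣S∣≡m
    ∣Sˡ∣≡ml : size (restrictˡ S) ≡ ml
    ∣Sˡ∣≡ml = m≤o⇒n≤p⇒o+p≡m+n⇒o≡m ml≤∣Sˡ∣ mr≤∣Sʳ∣ halves≡m
    ∣Sʳ∣≡mr : size (restrictʳ S) ≡ mr
    ∣Sʳ∣≡mr = m≤o⇒n≤p⇒o+p≡m+n⇒o≡m mr≤∣Sʳ∣ ml≤∣Sˡ∣
      (trans (+-comm (size (restrictʳ S)) _) (trans halves≡m (+-comm ml mr)))

lemma19 : (T l r : Tree) → node ⊙ l r ≼ T →
          (a al ar : ℕ) →
          IsAlphaHat (node ⊙ l r) a → IsAlphaHat l al → IsAlphaHat r ar →
          a ≡ al + ar
lemma19 _ l r _ a al ar αᵥ@(_ , min , ((_ , F , ∣S∣≡m) , _) , _)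
  αˡ@(ml , minˡ , γˡ , _) αʳ@(mr , minʳ , γʳ , _) =
  ≤-antisym a≤al+ar al+ar≤a
  where
  minᵥ : IsMinHat (node ⊙ l r) (ml + mr)
  minᵥ = IsMinHat-⊙ minˡ minʳ

  a≤al+ar : a ≤ al + ar
  a≤al+ar = IsAlphaHat⇒≤ minᵥ αᵥ (IsGammaHat-⊙ minˡ minʳ γˡ γʳ)

  al+ar≤a : al + ar ≤ a
  al+ar≤a with ⊙-optimal-split minˡ minʳ F (trans ∣S∣≡m (IsMinHat-unique min minᵥ))
  ... | kl , kr , refl , γkl , γkr =
    +-mono-≤ (IsAlphaHat⇒≤ minˡ αˡ γkl) (IsAlphaHat⇒≤ minʳ αʳ γkr)
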